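{- Suppose that $n$ is even and that there exists an Isbell family on $[n]=\{1,\dots,n\}$. Then there is a transitive avoidance game with board $[n]$ that is a Player I win.
   Context: An Isbell family on $[n]$ is a family $\mathcal{F}$ of subsets of $[n]$ which is an up-set (closed under taking supersets), contains exactly one of $S$ and $[n]\setminus S$ for every $S\subseteq [n]$, and whose automorphism group (permutations of $[n]$ mapping $\mathcal{F}$ onto $\mathcal{F}$) acts transitively on $[n]$. An avoidance game consists of a finite board $X$ and a family $\mathcal{L}$ of subsets of $X$ (lines); Player I and Player II alternately claim unclaimed points, Player I first; the first player to have claimed all points of some line loses; if the board fills with no line completed, it is a draw. The game is transitive if its automorphism group (permutations of $X$ mapping $\mathcal{L}$ onto $\mathcal{L}$) acts transitively on $X$. A Player I win means Player I has a strategy guaranteeing that Player II loses. -}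

module Defs where

open import Data.Nat using (ℕ)
open import Data.Bool using (Bool; true; false; not)
open import Data.Fin using (Fin)
open import Data.Fin.Subset using (Subset; _∈_; _∉_; _⊆_; _∪_; ⁅_⁆; ∁)
open import Data.Fin.Permutation using (Permutation′; _⟨$⟩ʳ_; _⟨$⟩ˡ_)
open import Data.Vec using (tabulate; lookup)
open import Data.Product using (Σ; ∃; _×_; _,_)
open import Relation.Binary.PropositionalEquality using (_≡_)
import Data.Empty
import Data.Sum
import Data.Fin.Subset

Family : ℕ → Set
Family n = Subset n → Bool

image : ∀ {n} → Permutation′ n → Subset n → Subset n
image σ S = tabulate (λ j → lookup S (σ ⟨$⟩ˡ j))

-- σ is an automorphism of the family 𝓕: σ maps 𝓕 onto 𝓕
-- (for a finite family and a bijection σ this is S ∈ 𝓕 ⇔ σ(S) ∈ 𝓕).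
IsAutomorphism : ∀ {n} → Family n → Permutation′ n → Set
IsAutomorphism 𝓕 σ = ∀ S → 𝓕 (image σ S) ≡ 𝓕 S

IsTransitive : ∀ {n} → Family n → Set
IsTransitive {n} 𝓕 = ∀ (i j : Fin n) → Σ (Permutation′ n) λ σ → IsAutomorphism 𝓕 σ × (σ ⟨$⟩ʳ i ≡ j)

IsUpSet : ∀ {n} → Family n → Set
IsUpSet 𝓕 = ∀ S T → S ⊆ T → 𝓕 S ≡ true → 𝓕 T ≡ true

IsSelfComplementary : ∀ {n} → Family n → Set
IsSelfComplementary 𝓕 = ∀ S → 𝓕 (∁ S) ≡ not (𝓕 S)

IsIsbell : ∀ {n} → Family n → Set
IsIsbell 𝓕 = IsUpSet 𝓕 × IsSelfComplementary 𝓕 × IsTransitive 𝓕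

CompletesLine : ∀ {n} → Family n → Subset n → Set
CompletesLine {n} 𝓛 A = Σ (Subset n) λ L → (𝓛 L ≡ true) × (L ⊆ A)

Unclaimed : ∀ {n} → Fin n → Subset n → Subset n → Set
Unclaimed x A B = (x ∉ A) × (x ∉ B)

-- Positions: A = points claimed by Player I, B = points claimed by Player II,
-- nobody has yet completed a line.
-- IWinsI 𝓛 A B : Player I to move, Player I can force that Player II loses.
-- IWinsII 𝓛 A B : Player II to move, Player I can force that Player II loses.
mutual
  data IWinsI {n} (𝓛 : Family n) (A B : Subset n) : Set where
    moveI : (x : Fin n) → Unclaimed x A B →
            (CompletesLine 𝓛 (A ∪ ⁅ x ⁆) → Data.Empty.⊥) →
            IWinsII 𝓛 (A ∪ ⁅ x ⁆) B → IWinsI 𝓛 A B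

  data IWinsII {n} (𝓛 : Family n) (A B : Subset n) : Set where
    -- the board is not full (otherwise the game is a draw), and every
    -- move of Player II either completes a line of II or leads to an I-win.
    moveII : (∃ λ x → Unclaimed x A B) →
             (∀ x → Unclaimed x A B →
                CompletesLine 𝓛 (B ∪ ⁅ x ⁆) Data.Sum.⊎ IWinsI 𝓛 A (B ∪ ⁅ x ⁆)) →
             IWinsII 𝓛 A B

PlayerIWin : ∀ {n} → Family n → Set
PlayerIWin 𝓛 = IWinsI 𝓛 Data.Fin.Subset.⊥ Data.Fin.Subset.⊥

module Submission where

open import Defs
open import Data.Nat using (ℕ; zero; suc; _+_; _∸_; _≤_; _<_; _≡ᵇ_; s≤s; z≤n)
open import Data.Nat.Divisibility using (_∣_; divides)
open import Data.Nat.Properties using (≤-refl; ≤-antisym; <⇒≤; <⇒≱; <-irrefl; <-≤-trans; m≤n⇒m<n∨m≡n; m≤m+n; +-∸-assoc; n∸n≡0; +-identityʳ; *-suc; *-identityʳ; +-0-commutativeMonoid; ≡ᵇ⇒≡; ≡⇒≡ᵇ)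
open import Data.Bool using (Bool; true; false; not; _∧_)
open import Data.Bool.Properties using (not-¬; T-≡; T-∧; T-not-≡)
open import Function.Bundles using (module Equivalence)
open import Data.Fin using (Fin; zero; suc)
open import Data.Fin.Properties using (any?) renaming (_≟_ to _≟ᶠ_)
open import Data.Fin.Subset
open import Data.Fin.Subset.Properties
open import Data.Fin.Permutation using (Permutation′; _⟨$⟩ˡ_; flip)
open import Data.Vec using ([]; _∷_; lookup; here; there)
open import Data.Vec.Properties using (lookup∘tabulate)
open import Data.Product using (Σ; ∃; _×_; _,_; proj₁; proj₂; swap; map₁; map₂)
open import Data.Sum using (_⊎_; inj₁; inj₂; [_,_]′)
open import Data.Empty using (⊥-elim)
open import Function using (_∘_)
open Equivalence using (to; from)
open import Relation.Nullary using (¬_; Dec; yes; no; ¬?; _×-dec_)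
open import Relation.Nullary.Decidable using (decidable-stable)
open import Relation.Binary.PropositionalEquality using (_≡_; _≢_; refl; sym; trans; cong; cong₂; subst; module ≡-Reasoning)
open import Algebra.Bundles using (CommutativeMonoid)
open import Algebra.Properties.CommutativeMonoid.Sum +-0-commutativeMonoid using (sum; sum-permute; sum-cong-≗)
import Algebra.Properties.CommutativeSemigroup as CommutativeSemigroupProperties

-- Let 𝓕 be an Isbell family on [n], n = 2h. In the strong game where the players
-- claim points until the board is full and the one whose final set lies in 𝓕 wins
-- (exactly one of them does, 𝓕 being self-dual), an extra point never hurts since 𝓕
-- is an up-set; so by strategy stealing Player I wins. Take as lines the h-sets
-- outside 𝓕; every automorphism of 𝓕 preserves them. Playing her strong-game
-- strategy, Player I holds at most h points and ends with an h-set in 𝓕, so she never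
-- completes a line, whereas Player II's final h-set is the complement of hers, a line.

indicator : Bool → ℕ
indicator true  = 1
indicator false = 0

∣p∣≡sum : ∀ {n} (p : Subset n) → ∣ p ∣ ≡ sum (indicator ∘ lookup p)
∣p∣≡sum []          = refl
∣p∣≡sum (true  ∷ p) = cong suc (∣p∣≡sum p)
∣p∣≡sum (false ∷ p) = ∣p∣≡sum p

∣image∣≡∣p∣ : ∀ {n} (σ : Permutation′ n) (p : Subset n) → ∣ image σ p ∣ ≡ ∣ p ∣
∣image∣≡∣p∣ {n} σ p = begin
  ∣ image σ p ∣                           ≡⟨ ∣p∣≡sum (image σ p) ⟩
  sum (indicator ∘ lookup (image σ p))    ≡⟨ sum-cong-≗ (cong indicator ∘ lookup∘tabulate σ⁻¹p) ⟩
  sum (indicator ∘ σ⁻¹p)                  ≡⟨ sum-permute (indicator ∘ lookup p) (flip σ) ⟨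
  sum (indicator ∘ lookup p)              ≡⟨ ∣p∣≡sum p ⟨
  ∣ p ∣                                   ∎
  where
  open ≡-Reasoning
  σ⁻¹p : Fin n → Bool
  σ⁻¹p = lookup p ∘ (σ ⟨$⟩ˡ_)

x∉p⇒∣p∪⁅x⁆∣≡1+∣p∣ : ∀ {n} {x} {p : Subset n} → x ∉ p → ∣ p ∪ ⁅ x ⁆ ∣ ≡ suc ∣ p ∣
x∉p⇒∣p∪⁅x⁆∣≡1+∣p∣ {x = zero}  {p = true  ∷ p} x∉p = ⊥-elim (x∉p here)
x∉p⇒∣p∪⁅x⁆∣≡1+∣p∣ {x = zero}  {p = false ∷ p} _   = cong (suc ∘ ∣_∣) (∪-identityʳ p)
x∉p⇒∣p∪⁅x⁆∣≡1+∣p∣ {x = suc x} {p = true  ∷ p} x∉p = cong suc (x∉p⇒∣p∪⁅x⁆∣≡1+∣p∣ (x∉p ∘ there))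
x∉p⇒∣p∪⁅x⁆∣≡1+∣p∣ {x = suc x} {p = false ∷ p} x∉p = x∉p⇒∣p∪⁅x⁆∣≡1+∣p∣ (x∉p ∘ there)

module _ {n : ℕ} where

  open CommutativeSemigroupProperties (CommutativeMonoid.commutativeSemigroup (∪-commutativeMonoid n))
    using (xy∙z≈xz∙y; x∙yz≈yx∙z)

  x∉p∪q⁺ : ∀ {x : Fin n} {p q} → x ∉ p → x ∉ q → x ∉ p ∪ q
  x∉p∪q⁺ {p = p} {q} x∉p x∉q = [ x∉p , x∉q ]′ ∘ x∈p∪q⁻ p q

  x∉p∪q⁻ : ∀ {x : Fin n} {p q} → x ∉ p ∪ q → x ∉ p × x ∉ q
  x∉p∪q⁻ x∉p∪q = x∉p∪q ∘ x∈p∪q⁺ ∘ inj₁ , x∉p∪q ∘ x∈p∪q⁺ ∘ inj₂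

  x∉p⇒∣∁[p∪⁅x⁆]∣<∣∁p∣ : ∀ {x} {p : Subset n} → x ∉ p → ∣ ∁ (p ∪ ⁅ x ⁆) ∣ < ∣ ∁ p ∣
  x∉p⇒∣∁[p∪⁅x⁆]∣<∣∁p∣ {x} {p} x∉p =
    p⊂q⇒∣p∣<∣q∣ (p⊂q⇒∁p⊃∁q (p⊆p∪q ⁅ x ⁆ , x , q⊆p∪q p ⁅ x ⁆ (x∈⁅x⁆ x) , x∉p))

  ∣p∣<∣q∣⇒∃∈q∉p : ∀ {p q : Subset n} → ∣ p ∣ < ∣ q ∣ → ∃ λ x → x ∈ q × x ∉ p
  ∣p∣<∣q∣⇒∃∈q∉p {p} {q} ∣p∣<∣q∣ with any? (λ x → x ∈? q ×-dec ¬? (x ∈? p))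
  ... | yes found = found
  ... | no none = ⊥-elim (<⇒≱ ∣p∣<∣q∣ (p⊆q⇒∣p∣≤∣q∣ q⊆p))
    where
    q⊆p : q ⊆ p
    q⊆p {x} x∈q = decidable-stable (x ∈? p) (λ x∉p → none (x , x∈q , x∉p))

  p⊆q⇒∣p∣≡∣q∣⇒p≡q : ∀ {p q : Subset n} → p ⊆ q → ∣ p ∣ ≡ ∣ q ∣ → p ≡ q
  p⊆q⇒∣p∣≡∣q∣⇒p≡q {p} {q} p⊆q ∣p∣≡∣q∣ = ⊆-antisym p⊆q q⊆p
    where
    q⊆p : q ⊆ p
    q⊆p {x} x∈q = decidable-stable (x ∈? p)
      (λ x∉p → <-irrefl ∣p∣≡∣q∣ (p⊂q⇒∣p∣<∣q∣ (p⊆q , x , x∈q , x∉p)))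

  p⊆∁q⇒p⊆∁[q∪⁅x⁆] : ∀ {p q : Subset n} {x} → p ⊆ ∁ q → x ∉ p → p ⊆ ∁ (q ∪ ⁅ x ⁆)
  p⊆∁q⇒p⊆∁[q∪⁅x⁆] p⊆∁q x∉p y∈p =
    x∉p⇒x∈∁p (x∉p∪q⁺ (x∈∁p⇒x∉p (p⊆∁q y∈p)) (x≢y⇒x∉⁅y⁆ λ { refl → x∉p y∈p }))

  p⊆∁q⇒p∪⁅x⁆⊆∁q : ∀ {p q : Subset n} {x} → p ⊆ ∁ q → x ∉ q → p ∪ ⁅ x ⁆ ⊆ ∁ q
  p⊆∁q⇒p∪⁅x⁆⊆∁q {p} {q} {x} p⊆∁q x∉q y∈p∪⁅x⁆ with x∈p∪q⁻ p ⁅ x ⁆ y∈p∪⁅x⁆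
  ... | inj₁ y∈p    = p⊆∁q y∈p
  ... | inj₂ y∈⁅x⁆ = x∉p⇒x∈∁p (subst (_∉ q) (sym (x∈⁅y⁆⇒x≡y x y∈⁅x⁆)) x∉q)

  [p∪⁅x⁆]∪⁅y⁆≡[p∪⁅y⁆]∪⁅x⁆ : ∀ p (x y : Fin n) → (p ∪ ⁅ x ⁆) ∪ ⁅ y ⁆ ≡ (p ∪ ⁅ y ⁆) ∪ ⁅ x ⁆
  [p∪⁅x⁆]∪⁅y⁆≡[p∪⁅y⁆]∪⁅x⁆ p x y = xy∙z≈xz∙y p ⁅ x ⁆ ⁅ y ⁆

  q∪[p∪⁅x⁆]≡[p∪q]∪⁅x⁆ : ∀ p q (x : Fin n) → q ∪ (p ∪ ⁅ x ⁆) ≡ (p ∪ q) ∪ ⁅ x ⁆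
  q∪[p∪⁅x⁆]≡[p∪q]∪⁅x⁆ p q x = x∙yz≈yx∙z q p ⁅ x ⁆

∀⊎⟶∃⊎∀ : ∀ {n} {P Q : Fin n → Set} → (∀ x → P x ⊎ Q x) → ∃ P ⊎ (∀ x → Q x)
∀⊎⟶∃⊎∀ {zero}  _ = inj₂ λ ()
∀⊎⟶∃⊎∀ {suc n} f with f zero | ∀⊎⟶∃⊎∀ (f ∘ suc)
... | inj₁ p₀ | _              = inj₁ (zero , p₀)
... | inj₂ _  | inj₁ (x , p)  = inj₁ (suc x , p)
... | inj₂ q₀ | inj₂ q        = inj₂ λ { zero → q₀ ; (suc x) → q x }

-- Over the empty ground set, ∁ ⊥ = ⊥.
¬IsSelfComplementary₀ : (𝓕 : Family 0) → ¬ IsSelfComplementary 𝓕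
¬IsSelfComplementary₀ 𝓕 sc = not-¬ refl (sc [])

module StrongGame {n : ℕ} (𝓕 : Family n) where

  Full : Subset n → Subset n → Set
  Full A B = ¬ ∃ λ x → Unclaimed x A B

  unclaimed? : ∀ (x : Fin n) A B → Dec (Unclaimed x A B)
  unclaimed? x A B = ¬? (x ∈? A) ×-dec ¬? (x ∈? B)

  free? : (A B : Subset n) → Dec (∃ λ x → Unclaimed x A B)
  free? A B = any? λ x → unclaimed? x A B

  -- Positions are seen from the player to move, who holds A against the opponent's B;
  -- Win A B (Lose A B) says that the player to move (the opponent) can force a final set in 𝓕.
  mutual
    data Win (A B : Subset n) : Set where
      final : Full A B → 𝓕 A ≡ true → Win A B
      move  : ∀ x → Unclaimed x A B → Lose B (A ∪ ⁅ x ⁆) → Win A B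

    data Lose (A B : Subset n) : Set where
      lose : (Full A B → 𝓕 B ≡ true) → (∀ x → Unclaimed x A B → Win B (A ∪ ⁅ x ⁆)) → Lose A B

  Full-sym : ∀ {A B} → Full A B → Full B A
  Full-sym full = full ∘ map₂ swap

  Full-reassign : ∀ {A B x} → Full B (A ∪ ⁅ x ⁆) → Full A (B ∪ ⁅ x ⁆)
  Full-reassign full (y , y∉A , y∉B∪⁅x⁆) =
    let y∉B , y∉⁅x⁆ = x∉p∪q⁻ y∉B∪⁅x⁆ in full (y , y∉B , x∉p∪q⁺ y∉A y∉⁅x⁆)

  Full-∁ : ∀ {A} → Full A (∁ A)
  Full-∁ (x , x∉A , x∉∁A) = x∉A (x∉∁p⇒x∈p x∉∁A)

  Win-full : ∀ {A B} → Full A B → Win A B → 𝓕 A ≡ true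
  Win-full _    (final _ A∈𝓕) = A∈𝓕
  Win-full full (move x u _)  = ⊥-elim (full (x , u))

  Lose-full : ∀ {A B} → Lose B A → Full B A → 𝓕 A ≡ true
  Lose-full (lose A∈𝓕 _) = A∈𝓕

  Unclaimed-exchange : ∀ {A B : Subset n} {x y} →
                       Unclaimed x A B → Unclaimed y B (A ∪ ⁅ x ⁆) → Unclaimed x A (B ∪ ⁅ y ⁆)
  Unclaimed-exchange (x∉A , x∉B) (_ , y∉A∪⁅x⁆) =
    x∉A , x∉p∪q⁺ x∉B (x≢y⇒x∉⁅y⁆ (x∉⁅y⁆⇒x≢y (proj₂ (x∉p∪q⁻ y∉A∪⁅x⁆)) ∘ sym))

  Lose-lastMove : ∀ {A B y} → Lose B A → Unclaimed y A B → Full A (B ∪ ⁅ y ⁆) → 𝓕 A ≡ true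
  Lose-lastMove (lose _ wins) u full = Win-full full (wins _ (swap u))

  module _ (up : IsUpSet 𝓕) where

    mutual
      Win-monoˡ : ∀ {A B x} → Unclaimed x A B → Win A B → Win (A ∪ ⁅ x ⁆) B
      Win-monoˡ u (final full _) = ⊥-elim (full (_ , u))
      Win-monoˡ {A} {B} {x} (x∉A , x∉B) (move y (y∉A , y∉B) l) with y ≟ᶠ x
      ... | yes refl = Lose⇒Win l
      ... | no y≢x   =
        move y (x∉p∪q⁺ y∉A (x≢y⇒x∉⁅y⁆ y≢x) , y∉B)
          (subst (Lose B) ([p∪⁅x⁆]∪⁅y⁆≡[p∪⁅y⁆]∪⁅x⁆ A y x)
            (Lose-monoʳ (x∉p∪q⁺ x∉A (x≢y⇒x∉⁅y⁆ (y≢x ∘ sym)) , x∉B) l))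

      Lose-monoʳ : ∀ {A B x} → Unclaimed x A B → Lose B A → Lose B (A ∪ ⁅ x ⁆)
      Lose-monoʳ {A} {B} {x} u (lose _ wins) =
        lose A∪⁅x⁆∈𝓕 λ y u′ →
          Win-monoˡ (Unclaimed-exchange u u′) (wins y (map₂ (proj₁ ∘ x∉p∪q⁻) u′))
        where
        A∪⁅x⁆∈𝓕 : Full B (A ∪ ⁅ x ⁆) → 𝓕 (A ∪ ⁅ x ⁆) ≡ true
        A∪⁅x⁆∈𝓕 full =
          up A (A ∪ ⁅ x ⁆) (p⊆p∪q ⁅ x ⁆) (Win-full (Full-reassign full) (wins x (swap u)))

      -- Having the move is never a disadvantage.
      Lose⇒Win : ∀ {A B} → Lose B A → Win A B
      Lose⇒Win {A} {B} l with free? A B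
      ... | yes (x , u) = move x u (Lose-monoʳ u l)
      ... | no full     = final full (Lose-full l (Full-sym full))

  module _ (up : IsUpSet 𝓕) (sc : IsSelfComplementary 𝓕) where

    Full-𝓕 : ∀ {A B} → Full A B → 𝓕 A ≡ false → 𝓕 B ≡ true
    Full-𝓕 {A} {B} full A∉𝓕 = up (∁ A) B ∁A⊆B (trans (sc A) (cong not A∉𝓕))
      where
      ∁A⊆B : ∁ A ⊆ B
      ∁A⊆B {x} x∈∁A = decidable-stable (x ∈? B) λ x∉B → full (x , x∈∁p⇒x∉p x∈∁A , x∉B)

    determinedAtFull : ∀ {A B} → Full A B → Win A B ⊎ Lose A B
    determinedAtFull {A} full with 𝓕 A in eq
    ... | true  = inj₁ (final full eq)
    ... | false = inj₂ (lose (λ _ → Full-𝓕 full eq) (λ x u → ⊥-elim (full (x , u))))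

    mutual
      determined′ : ∀ m A B → ∣ ∁ (A ∪ B) ∣ < m → Win A B ⊎ Lose A B
      determined′ (suc m) A B (s≤s bound) with free? A B
      ... | no full = determinedAtFull full
      ... | yes someFree
        with ∀⊎⟶∃⊎∀ {n} (λ x → outcomeOfMove m A B bound x (unclaimed? x A B))
      ...   | inj₁ (x , u , l) = inj₁ (move x u l)
      ...   | inj₂ wins        = inj₂ (lose (λ full → ⊥-elim (full someFree)) wins)

      outcomeOfMove : ∀ m A B → ∣ ∁ (A ∪ B) ∣ ≤ m → ∀ x → Dec (Unclaimed x A B) →
                      (Unclaimed x A B × Lose B (A ∪ ⁅ x ⁆)) ⊎ (Unclaimed x A B → Win B (A ∪ ⁅ x ⁆))
      outcomeOfMove m A B bound x (no ¬u) = inj₂ (⊥-elim ∘ ¬u)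
      outcomeOfMove m A B bound x (yes u@(x∉A , x∉B))
        with determined′ m B (A ∪ ⁅ x ⁆) (<-≤-trans fewerFree bound)
        where
        fewerFree : ∣ ∁ (B ∪ (A ∪ ⁅ x ⁆)) ∣ < ∣ ∁ (A ∪ B) ∣
        fewerFree = subst (λ S → ∣ ∁ S ∣ < ∣ ∁ (A ∪ B) ∣) (sym (q∪[p∪⁅x⁆]≡[p∪q]∪⁅x⁆ A B x))
                      (x∉p⇒∣∁[p∪⁅x⁆]∣<∣∁p∣ (x∉p∪q⁺ x∉A x∉B))
      ... | inj₁ w = inj₂ λ _ → w
      ... | inj₂ l = inj₁ (u , l)

    determined : ∀ A B → Win A B ⊎ Lose A B
    determined A B = determined′ (suc ∣ ∁ (A ∪ B) ∣) A B ≤-refl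

    firstPlayerWins : Fin n → Win ⊥ ⊥
    firstPlayerWins x with determined ⊥ ⊥
    ... | inj₁ w = w
    ... | inj₂ l = move x (∉⊥ , ∉⊥) (Lose-monoʳ up (∉⊥ , ∉⊥) l)

module AvoidanceGame {n : ℕ} (𝓕 : Family n) (up : IsUpSet 𝓕) (sc : IsSelfComplementary 𝓕)
                     (h : ℕ) (n≡h+h : n ≡ h + h) where

  open StrongGame 𝓕

  Lines : Family n
  Lines L = (∣ L ∣ ≡ᵇ h) ∧ not (𝓕 L)

  Lines⁻ : ∀ {L} → Lines L ≡ true → ∣ L ∣ ≡ h × 𝓕 L ≡ false
  Lines⁻ isLine =
    let ∣L∣≡ᵇh , L∉𝓕 = to T-∧ (from T-≡ isLine) in ≡ᵇ⇒≡ _ _ ∣L∣≡ᵇh , to T-not-≡ L∉𝓕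

  Lines⁺ : ∀ {L} → ∣ L ∣ ≡ h → 𝓕 L ≡ false → Lines L ≡ true
  Lines⁺ ∣L∣≡h L∉𝓕 = to T-≡ (from T-∧ (≡⇒≡ᵇ _ _ ∣L∣≡h , from T-not-≡ L∉𝓕))

  Lines-transitive : IsTransitive 𝓕 → IsTransitive Lines
  Lines-transitive transitive i j =
    let σ , automorphism , σi≡j = transitive i j
    in σ , (λ S → cong₂ (λ c b → (c ≡ᵇ h) ∧ not b) (∣image∣≡∣p∣ σ S) (automorphism S)) , σi≡j

  ∣∁p∣≡h+[h∸∣p∣] : ∀ {p : Subset n} → ∣ p ∣ ≤ h → ∣ ∁ p ∣ ≡ h + (h ∸ ∣ p ∣)
  ∣∁p∣≡h+[h∸∣p∣] {p} ∣p∣≤h = begin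
    ∣ ∁ p ∣          ≡⟨ ∣∁p∣≡n∸∣p∣ p ⟩
    n ∸ ∣ p ∣        ≡⟨ cong (_∸ ∣ p ∣) n≡h+h ⟩
    h + h ∸ ∣ p ∣    ≡⟨ +-∸-assoc h ∣p∣≤h ⟩
    h + (h ∸ ∣ p ∣)  ∎
    where open ≡-Reasoning

  h≤∣∁p∣ : ∀ {p : Subset n} → ∣ p ∣ ≤ h → h ≤ ∣ ∁ p ∣
  h≤∣∁p∣ {p} ∣p∣≤h = subst (h ≤_) (sym (∣∁p∣≡h+[h∸∣p∣] {p} ∣p∣≤h)) (m≤m+n h _)

  ∣∁p∣≡h : ∀ {p : Subset n} → ∣ p ∣ ≡ h → ∣ ∁ p ∣ ≡ h
  ∣∁p∣≡h {p} refl = begin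
    ∣ ∁ p ∣                  ≡⟨ ∣∁p∣≡h+[h∸∣p∣] {p} ≤-refl ⟩
    ∣ p ∣ + (∣ p ∣ ∸ ∣ p ∣)  ≡⟨ cong (∣ p ∣ +_) (n∸n≡0 ∣ p ∣) ⟩
    ∣ p ∣ + 0                ≡⟨ +-identityʳ ∣ p ∣ ⟩
    ∣ p ∣                    ∎
    where open ≡-Reasoning

  unclaimedExists : ∀ {A B : Subset n} → ∣ A ∣ ≤ h → ∣ B ∣ < h → ∃ λ x → Unclaimed x A B
  unclaimedExists {A} ∣A∣≤h ∣B∣<h =
    map₂ (map₁ x∈∁p⇒x∉p) (∣p∣<∣q∣⇒∃∈q∉p (<-≤-trans ∣B∣<h (h≤∣∁p∣ {A} ∣A∣≤h)))

  lastMoveFills : ∀ {A B : Subset n} {y} → B ⊆ ∁ A → Unclaimed y A B →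
                  suc ∣ B ∣ ≡ h → ∣ A ∣ ≡ h → B ∪ ⁅ y ⁆ ≡ ∁ A
  lastMoveFills {A} B⊆∁A (y∉A , y∉B) 1+∣B∣≡h ∣A∣≡h =
    p⊆q⇒∣p∣≡∣q∣⇒p≡q (p⊆∁q⇒p∪⁅x⁆⊆∁q B⊆∁A y∉A)
      (trans (x∉p⇒∣p∪⁅x⁆∣≡1+∣p∣ y∉B) (trans 1+∣B∣≡h (sym (∣∁p∣≡h {A} ∣A∣≡h))))

  Lose⇒A∈𝓕 : ∀ {A B : Subset n} {y} → Lose B A → B ⊆ ∁ A → Unclaimed y A B →
             suc ∣ B ∣ ≡ h → ∣ A ∣ ≡ h → 𝓕 A ≡ true
  Lose⇒A∈𝓕 l B⊆∁A u 1+∣B∣≡h ∣A∣≡h =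
    Lose-lastMove l u (subst (Full _) (sym (lastMoveFills B⊆∁A u 1+∣B∣≡h ∣A∣≡h)) Full-∁)

  Lose⇒¬CompletesLine : ∀ {A B : Subset n} → Lose B A → B ⊆ ∁ A → suc ∣ B ∣ ≡ ∣ A ∣ → ∣ A ∣ ≤ h →
                         ¬ CompletesLine Lines A
  Lose⇒¬CompletesLine {A} l B⊆∁A 1+∣B∣≡∣A∣ ∣A∣≤h (L , isLine , L⊆A)
    with Lines⁻ isLine | unclaimedExists ∣A∣≤h (subst (_≤ h) (sym 1+∣B∣≡∣A∣) ∣A∣≤h)
  ... | ∣L∣≡h , L∉𝓕 | _ , u =
    not-¬ (Lose⇒A∈𝓕 l B⊆∁A u (trans 1+∣B∣≡∣A∣ ∣A∣≡h) ∣A∣≡h) (trans (cong 𝓕 (sym L≡A)) L∉𝓕)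
    where
    ∣A∣≡h : ∣ A ∣ ≡ h
    ∣A∣≡h = ≤-antisym ∣A∣≤h (subst (_≤ ∣ A ∣) ∣L∣≡h (p⊆q⇒∣p∣≤∣q∣ L⊆A))
    L≡A : L ≡ A
    L≡A = p⊆q⇒∣p∣≡∣q∣⇒p≡q L⊆A (trans ∣L∣≡h (sym ∣A∣≡h))

  Lose⇒lastMoveCompletesLine : ∀ {A B : Subset n} {y} → Lose B A → B ⊆ ∁ A → Unclaimed y A B →
                               suc ∣ B ∣ ≡ h → ∣ A ∣ ≡ h → CompletesLine Lines (B ∪ ⁅ y ⁆)
  Lose⇒lastMoveCompletesLine {A} {B} {y} l B⊆∁A u 1+∣B∣≡h ∣A∣≡h =
    B ∪ ⁅ y ⁆ , Lines⁺ (trans (x∉p⇒∣p∪⁅x⁆∣≡1+∣p∣ (proj₂ u)) 1+∣B∣≡h) B∪⁅y⁆∉𝓕 , ⊆-refl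
    where
    open ≡-Reasoning
    B∪⁅y⁆∉𝓕 : 𝓕 (B ∪ ⁅ y ⁆) ≡ false
    B∪⁅y⁆∉𝓕 = begin
      𝓕 (B ∪ ⁅ y ⁆)  ≡⟨ cong 𝓕 (lastMoveFills B⊆∁A u 1+∣B∣≡h ∣A∣≡h) ⟩
      𝓕 (∁ A)        ≡⟨ sc A ⟩
      not (𝓕 A)      ≡⟨ cong not (Lose⇒A∈𝓕 l B⊆∁A u 1+∣B∣≡h ∣A∣≡h) ⟩
      false          ∎

  mutual
    fromWin : ∀ {A B : Subset n} → Win A B → B ⊆ ∁ A → ∣ B ∣ ≡ ∣ A ∣ → ∣ A ∣ < h →
              IWinsI Lines A B
    fromWin (final full _) _ ∣B∣≡∣A∣ ∣A∣<h =
      ⊥-elim (full (unclaimedExists (<⇒≤ ∣A∣<h) (subst (_< h) (sym ∣B∣≡∣A∣) ∣A∣<h)))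
    fromWin {A} {B} (move x u l) B⊆∁A ∣B∣≡∣A∣ ∣A∣<h =
      moveI x u (Lose⇒¬CompletesLine l B⊆∁A′ 1+∣B∣≡∣A′∣ ∣A′∣≤h)
                (fromLose l B⊆∁A′ 1+∣B∣≡∣A′∣ ∣A′∣≤h)
      where
      ∣A′∣≡1+∣A∣ : ∣ A ∪ ⁅ x ⁆ ∣ ≡ suc ∣ A ∣
      ∣A′∣≡1+∣A∣ = x∉p⇒∣p∪⁅x⁆∣≡1+∣p∣ (proj₁ u)
      B⊆∁A′ : B ⊆ ∁ (A ∪ ⁅ x ⁆)
      B⊆∁A′ = p⊆∁q⇒p⊆∁[q∪⁅x⁆] B⊆∁A (proj₂ u)
      1+∣B∣≡∣A′∣ : suc ∣ B ∣ ≡ ∣ A ∪ ⁅ x ⁆ ∣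
      1+∣B∣≡∣A′∣ = trans (cong suc ∣B∣≡∣A∣) (sym ∣A′∣≡1+∣A∣)
      ∣A′∣≤h : ∣ A ∪ ⁅ x ⁆ ∣ ≤ h
      ∣A′∣≤h = subst (_≤ h) (sym ∣A′∣≡1+∣A∣) ∣A∣<h

    fromLose : ∀ {A B : Subset n} → Lose B A → B ⊆ ∁ A → suc ∣ B ∣ ≡ ∣ A ∣ → ∣ A ∣ ≤ h →
               IWinsII Lines A B
    fromLose {A} {B} l@(lose _ wins) B⊆∁A 1+∣B∣≡∣A∣ ∣A∣≤h =
      moveII (unclaimedExists ∣A∣≤h (subst (_≤ h) (sym 1+∣B∣≡∣A∣) ∣A∣≤h)) reply
      where
      reply : ∀ y → Unclaimed y A B → CompletesLine Lines (B ∪ ⁅ y ⁆) ⊎ IWinsI Lines A (B ∪ ⁅ y ⁆)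
      reply y u with m≤n⇒m<n∨m≡n ∣A∣≤h
      ... | inj₁ ∣A∣<h = inj₂ (fromWin (wins y (swap u)) (p⊆∁q⇒p∪⁅x⁆⊆∁q B⊆∁A (proj₁ u))
                                 (trans (x∉p⇒∣p∪⁅x⁆∣≡1+∣p∣ (proj₂ u)) 1+∣B∣≡∣A∣) ∣A∣<h)
      ... | inj₂ ∣A∣≡h = inj₁ (Lose⇒lastMoveCompletesLine l B⊆∁A u (trans 1+∣B∣≡∣A∣ ∣A∣≡h) ∣A∣≡h)

  playerIWins : Fin n → 0 < h → PlayerIWin Lines
  playerIWins x 0<h =
    fromWin (firstPlayerWins up sc x) ⊥⊆ refl (subst (_< h) (sym (∣⊥∣≡0 n)) 0<h)

proposition7 : (n : ℕ) → 2 ∣ n → Σ (Family n) IsIsbell →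
    Σ (Family n) λ 𝓛 → IsTransitive 𝓛 × PlayerIWin 𝓛
proposition7 zero _ (𝓕 , _ , sc , _) = ⊥-elim (¬IsSelfComplementary₀ 𝓕 sc)
proposition7 (suc m) (divides zero ())
proposition7 (suc m) (divides h@(suc _) n≡h*2) (𝓕 , up , sc , transitive) =
  Lines , Lines-transitive transitive , playerIWins zero (s≤s z≤n)
  where
  open AvoidanceGame 𝓕 up sc h (trans n≡h*2 (trans (*-suc h 1) (cong (h +_) (*-identityʳ h))))
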